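{- Let $Act$ be a set with a partition $\{Act^r,Act^l,Act^{bi}\}$, let $F=\mathcal{P}^{Act}$, and let $c:X\to\mathcal{P}(X)^{Act}$, $d:Y\to\mathcal{P}(Y)^{Act}$ be labeled transition systems. For each set $X$ define $\sqsubseteq^{cc}_X$ on $\mathcal{P}(X)^{Act}$ by $\alpha\sqsubseteq^{cc}_X\alpha'$ iff $\alpha(a)\subseteq\alpha'(a)$ for all $a\in Act^r\cup Act^{bi}$ and $\alpha(a)\supseteq\alpha'(a)$ for all $a\in Act^l\cup Act^{bi}$. Then a relation $S\subseteq X\times Y$ is an $(Act^r,Act^l)$-simulation between $c$ and $d$ if and only if for all $(x,y)\in S$ we have $(c(x),d(y))\in\mathrm{Rel}_{\sqsubseteq^{cc}}(F)(S)$, i.e. there exist $p^*\in\mathcal{P}(X)^{Act}$, $q^*\in\mathcal{P}(Y)^{Act}$ with $c(x)\sqsubseteq^{cc}_X p^*$, $(p^*,q^*)\in\mathrm{Rel}(F)(S)$ and $q^*\sqsubseteq^{cc}_Y d(y)$.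
   Context: $\mathcal{P}$ is the covariant powerset functor and $F=\mathcal{P}^{Act}$, $X\mapsto(\mathcal{P}X)^{Act}$, $Ff(\alpha)(a)=f(\alpha(a))$. Write $x\xrightarrow{a}x'$ iff $x'\in c(x)(a)$ (similarly for $d$). An $(Act^r,Act^l)$-simulation between $c$ and $d$ is a relation $S\subseteq X\times Y$ such that for every $(x,y)\in S$: for all $a\in Act^r\cup Act^{bi}$ and all $x\xrightarrow{a}x'$ there is $y\xrightarrow{a}y'$ with $(x',y')\in S$; and for all $a\in Act^l\cup Act^{bi}$ and all $y\xrightarrow{a}y'$ there is $x\xrightarrow{a}x'$ with $(x',y')\in S$. For $R\subseteq X_1\times X_2$ with projections $r_1,r_2$: $\mathrm{Rel}(F)(R)=\{(u,v)\mid\exists w\in F(R).\,Fr_1(w)=u,\ Fr_2(w)=v\}$ (for $F=\mathcal{P}^{Act}$: for every $a$, each element of $u(a)$ is related to some element of $v(a)$ and vice versa), and $\mathrm{Rel}_{\sqsubseteq}(F)(R)=\{(u,v)\mid\exists w\in F(R).\,u\sqsubseteq_{X_1}Fr_1(w)\wedge Fr_2(w)\sqsubseteq_{X_2}v\}$. -}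

module Defs where

open import Data.Product using (Σ; ∃; _×_; _,_; proj₁; proj₂)
open import Relation.Binary.PropositionalEquality using (_≡_)

𝒫 : Set → Set₁
𝒫 X = X → Set

_⊆_ : {X : Set} → 𝒫 X → 𝒫 X → Set
A ⊆ B = ∀ x → A x → B x

_≐_ : {X : Set} → 𝒫 X → 𝒫 X → Set
A ≐ B = (A ⊆ B) × (B ⊆ A)

𝒫map : {X Y : Set} → (X → Y) → 𝒫 X → 𝒫 Y
𝒫map f A y = ∃ λ x → A x × f x ≡ y

-- Partition of Act into three blocks r, l, bi.
data Kind : Set where
  r l bi : Kind

IsRB : Kind → Set
IsRB r = Data.Unit.⊤ where import Data.Unit
IsRB l = Data.Empty.⊥ where import Data.Empty
IsRB bi = Data.Unit.⊤ where import Data.Unit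

IsLB : Kind → Set
IsLB r = Data.Empty.⊥ where import Data.Empty
IsLB l = Data.Unit.⊤ where import Data.Unit
IsLB bi = Data.Unit.⊤ where import Data.Unit

module LTS (Act : Set) (kind : Act → Kind) where

  F : Set → Set₁
  F X = Act → 𝒫 X

  Fmap : {X Y : Set} → (X → Y) → F X → F Y
  Fmap f α a = 𝒫map f (α a)

  _≐F_ : {X : Set} → F X → F X → Set
  α ≐F β = ∀ a → α a ≐ β a

  _⊑cc_ : {X : Set} → F X → F X → Set
  α ⊑cc α' = (∀ a → IsRB (kind a) → α a ⊆ α' a)
           × (∀ a → IsLB (kind a) → α' a ⊆ α a)

  Pairs : {X Y : Set} → (X → Y → Set) → Set
  Pairs {X} {Y} R = Σ X λ x → Σ Y λ y → R x y

  π₁ : {X Y : Set} {R : X → Y → Set} → Pairs R → X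
  π₁ (x , _ , _) = x

  π₂ : {X Y : Set} {R : X → Y → Set} → Pairs R → Y
  π₂ (_ , y , _) = y

  RelF : {X Y : Set} → (X → Y → Set) → F X → F Y → Set₁
  RelF R u v = ∃ λ (w : F (Pairs R)) → (Fmap π₁ w ≐F u) × (Fmap π₂ w ≐F v)

  RelCC : {X Y : Set} → (X → Y → Set) → F X → F Y → Set₁
  RelCC R u v = ∃ λ (w : F (Pairs R)) → (u ⊑cc Fmap π₁ w) × (Fmap π₂ w ⊑cc v)

  IsSimulation : {X Y : Set} → (X → F X) → (Y → F Y) → (X → Y → Set) → Set
  IsSimulation {X} {Y} c d S = ∀ x y → S x y →
      (∀ a → IsRB (kind a) → ∀ x' → c x a x' → ∃ λ y' → d y a y' × S x' y')
    × (∀ a → IsLB (kind a) → ∀ y' → d y a y' → ∃ λ x' → c x a x' × S x' y')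

{-# OPTIONS --safe #-}
module Submission where

open import Defs
open import Data.Product using (∃; _×_; _,_; proj₁; proj₂)
open import Relation.Binary.PropositionalEquality using (refl)

-- Both directions work one label at a time. A lifting witness w : F(S) relates the two
-- projections of w(a) back and forth, and weakening along ⊑cc preserves exactly the half
-- of this needed on each block of labels. Conversely, given a simulation, the pairs of
-- S-related a-successors of x and y form a witness whose projections are ⊑cc-between
-- c(x) and d(y).

module Simulation (Act : Set) (kind : Act → Kind) where

  open LTS Act kind

  private
    variable
      X Y : Set
      R : X → Y → Set

  ⊆-refl : {A : 𝒫 X} → A ⊆ A
  ⊆-refl _ Ax = Ax

  ⊆-trans : {A B C : 𝒫 X} → A ⊆ B → B ⊆ C → A ⊆ C
  ⊆-trans A⊆B B⊆C x Ax = B⊆C x (A⊆B x Ax)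

  Forth : (X → Y → Set) → 𝒫 X → 𝒫 Y → Set
  Forth R A B = ∀ x → A x → ∃ λ y → B y × R x y

  Back : (X → Y → Set) → 𝒫 X → 𝒫 Y → Set
  Back R A B = ∀ y → B y → ∃ λ x → A x × R x y

  Forth-mono : {A A′ : 𝒫 X} {B B′ : 𝒫 Y} →
               A′ ⊆ A → B ⊆ B′ → Forth R A B → Forth R A′ B′
  Forth-mono A′⊆A B⊆B′ forth x A′x with forth x (A′⊆A x A′x)
  ... | y , By , Rxy = y , B⊆B′ y By , Rxy

  Back-mono : {A A′ : 𝒫 X} {B B′ : 𝒫 Y} →
              B′ ⊆ B → A ⊆ A′ → Back R A B → Back R A′ B′
  Back-mono B′⊆B A⊆A′ back y B′y with back y (B′⊆B y B′y)
  ... | x , Ax , Rxy = x , A⊆A′ x Ax , Rxy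

  image-Forth : (W : 𝒫 (Pairs R)) → Forth R (𝒫map π₁ W) (𝒫map π₂ W)
  image-Forth W x ((.x , y , Rxy) , Wp , refl) = y , ((x , y , Rxy) , Wp , refl) , Rxy

  image-Back : (W : 𝒫 (Pairs R)) → Back R (𝒫map π₁ W) (𝒫map π₂ W)
  image-Back W y ((x , .y , Rxy) , Wp , refl) = x , ((x , y , Rxy) , Wp , refl) , Rxy

  pairsIn : {R : X → Y → Set} → 𝒫 X → 𝒫 Y → 𝒫 (Pairs R)
  pairsIn A B (x , y , _) = A x × B y

  π₁-pairsIn-⊆ : {A : 𝒫 X} {B : 𝒫 Y} → 𝒫map π₁ (pairsIn {R = R} A B) ⊆ A
  π₁-pairsIn-⊆ x (_ , (Ax , _) , refl) = Ax

  π₂-pairsIn-⊆ : {A : 𝒫 X} {B : 𝒫 Y} → 𝒫map π₂ (pairsIn {R = R} A B) ⊆ B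
  π₂-pairsIn-⊆ y (_ , (_ , By) , refl) = By

  Forth⇒⊆π₁-pairsIn : {A : 𝒫 X} {B : 𝒫 Y} → Forth R A B → A ⊆ 𝒫map π₁ (pairsIn {R = R} A B)
  Forth⇒⊆π₁-pairsIn forth x Ax with forth x Ax
  ... | y , By , Rxy = (x , y , Rxy) , (Ax , By) , refl

  Back⇒⊆π₂-pairsIn : {A : 𝒫 X} {B : 𝒫 Y} → Back R A B → B ⊆ 𝒫map π₂ (pairsIn {R = R} A B)
  Back⇒⊆π₂-pairsIn back y By with back y By
  ... | x , Ax , Rxy = (x , y , Rxy) , (Ax , By) , refl

  RelF-Fmap-π : (w : F (Pairs R)) → RelF R (Fmap π₁ w) (Fmap π₂ w)
  RelF-Fmap-π w = w , (λ a → ⊆-refl , ⊆-refl) , (λ a → ⊆-refl , ⊆-refl)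

  -- IsSimulation c d S unfolds definitionally to ∀ x y → S x y → Transfer S (c x) (d y).
  Transfer : (X → Y → Set) → F X → F Y → Set
  Transfer R α β = (∀ a → IsRB (kind a) → Forth R (α a) (β a))
                 × (∀ a → IsLB (kind a) → Back R (α a) (β a))

  Rel⊑ : (X → Y → Set) → F X → F Y → Set₁
  Rel⊑ {X} {Y} R α β = ∃ λ (p : F X) → ∃ λ (q : F Y) → α ⊑cc p × RelF R p q × q ⊑cc β

  Transfer⇒Rel⊑ : {α : F X} {β : F Y} → Transfer R α β → Rel⊑ R α β
  Transfer⇒Rel⊑ {R = R} {α} {β} (forth , back) =
    Fmap π₁ w , Fmap π₂ w ,
    ((λ a k → Forth⇒⊆π₁-pairsIn (forth a k)) , (λ a _ → π₁-pairsIn-⊆)) ,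
    RelF-Fmap-π w ,
    ((λ a _ → π₂-pairsIn-⊆) , (λ a k → Back⇒⊆π₂-pairsIn (back a k)))
    where
    w : F (Pairs R)
    w a = pairsIn (α a) (β a)

  Rel⊑⇒Transfer : {α : F X} {β : F Y} → Rel⊑ R α β → Transfer R α β
  Rel⊑⇒Transfer (p , q , (α⊆p , p⊆α) , (w , p≐w₁ , q≐w₂) , (q⊆β , β⊆q)) =
    (λ a k → Forth-mono (⊆-trans (α⊆p a k) (proj₂ (p≐w₁ a)))
                        (⊆-trans (proj₁ (q≐w₂ a)) (q⊆β a k))
                        (image-Forth (w a))) ,
    (λ a k → Back-mono (⊆-trans (β⊆q a k) (proj₂ (q≐w₂ a)))
                       (⊆-trans (proj₁ (p≐w₁ a)) (p⊆α a k))
                       (image-Back (w a)))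

proposition1 : (Act : Set) (kind : Act → Kind) {X Y : Set}
    (c : X → LTS.F Act kind X) (d : Y → LTS.F Act kind Y) (S : X → Y → Set) →
    (LTS.IsSimulation Act kind c d S →
      (∀ x y → S x y → ∃ λ (p : LTS.F Act kind X) → ∃ λ (q : LTS.F Act kind Y) →
        LTS._⊑cc_ Act kind (c x) p × LTS.RelF Act kind S p q × LTS._⊑cc_ Act kind q (d y)))
    × ((∀ x y → S x y → ∃ λ (p : LTS.F Act kind X) → ∃ λ (q : LTS.F Act kind Y) →
        LTS._⊑cc_ Act kind (c x) p × LTS.RelF Act kind S p q × LTS._⊑cc_ Act kind q (d y))
      → LTS.IsSimulation Act kind c d S)
proposition1 Act kind c d S =
  (λ simulation x y Sxy → Transfer⇒Rel⊑ (simulation x y Sxy)) ,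
  (λ factorisation x y Sxy → Rel⊑⇒Transfer (factorisation x y Sxy))
  where open Simulation Act kind
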